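{- Let $H=(V,E)$ be a connected $r$-cyclic $k$-graph with $n$ vertices and $m$ edges, and let $H_1=(V_1,E_1)$ be a connected subgraph of $H$. If $H_1$ is $r_1$-cyclic, then $r_1\le r$.
   Context: A $k$-graph is a pair $H=(V,E)$ with $V$ a nonempty finite set and $E$ a set of $k$-element subsets of $V$. A subgraph of $H$ is $H'=(V',E')$ where $E'\subseteq E$ and $V'=\bigcup_{e\in E'}e$. A path is an alternating sequence $v_0e_1v_1\cdots e_sv_s$ of distinct vertices and edges with $v_{j-1},v_j\in e_j$; a $k$-graph is connected if any two vertices lie on a common path. A connected $k$-graph with $n$ vertices and $m$ edges is $r$-cyclic if $n=m(k-1)-r+1$. -}

module Defs where

open import Data.Nat using (ℕ; suc)
open import Data.Integer as ℤ using (ℤ; +_)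
open import Data.Product using (_×_; Σ-syntax; ∃-syntax)
open import Data.List using (List; []; _∷_; length)
open import Data.List.Relation.Unary.All using (All)
open import Data.List.Relation.Unary.Unique.Propositional using (Unique)
import Data.List.Membership.Propositional as L
open import Data.Fin using (Fin)
open import Data.Fin.Subset using (Subset; _∈_; _⊆_; ∣_∣; ⋃; Nonempty)
open import Relation.Binary.PropositionalEquality using (_≡_)

record KGraph (N k : ℕ) : Set where
  field
    V        : Subset N
    E        : List (Subset N)
    V-ne     : Nonempty V
    E-uniq   : Unique E
    E-card   : All (λ e → ∣ e ∣ ≡ k) E
    E-sub    : All (λ e → e ⊆ V) E

open KGraph public

nV : ∀ {N k} → KGraph N k → ℕ
nV H = ∣ V H ∣

mE : ∀ {N k} → KGraph N k → ℕ
mE H = length (E H)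

-- Alternating sequence v₀ e₁ v₁ ⋯ eₛ vₛ with edges from the given edge list,
-- v_{j-1}, v_j ∈ e_j.  Vertex list vs, edge list es.
data Chain {N : ℕ} (Es : List (Subset N)) : List (Fin N) → List (Subset N) → Set where
  single : (v : Fin N) → Chain Es (v ∷ []) []
  step   : ∀ {v w vs es} (e : Subset N) → e L.∈ Es → v ∈ e → w ∈ e →
           Chain Es (w ∷ vs) es → Chain Es (v ∷ w ∷ vs) (e ∷ es)

record Path {N k : ℕ} (H : KGraph N k) : Set where
  field
    verts    : List (Fin N)
    edges    : List (Subset N)
    chain    : Chain (E H) verts edges
    verts-V  : All (λ v → v ∈ V H) verts
    v-uniq   : Unique verts
    e-uniq   : Unique edges

open Path public

Connected : ∀ {N k} → KGraph N k → Set
Connected H = ∀ u v → u ∈ V H → v ∈ V H →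
  ∃[ P ] (u L.∈ verts {H = H} P × v L.∈ verts {H = H} P)

Cyclic : ∀ {N k} → ℤ → KGraph N k → Set
Cyclic {k = k} r H =
  Connected H ×
  (+ nV H) ≡ ((+ mE H) ℤ.* ((+ k) ℤ.- (+ 1))) ℤ.- r ℤ.+ (+ 1)

Subgraph : ∀ {N k} → KGraph N k → KGraph N k → Set
Subgraph H₁ H = (∀ e → e L.∈ E H₁ → e L.∈ E H) × (V H₁ ≡ ⋃ (E H₁))

module Submission where

-- Write k = k' + 1, and for a k-graph G put n(G) = |V G|, m(G) = |E G|.
-- Being r-cyclic means r + n = k'·m + 1, so for H₁ ⊆ H the claim r₁ ≤ r
-- is equivalent to the counting inequality
--     n(H) + k'·m(H₁) ≤ n(H₁) + k'·m(H).
-- We prove it by growing a vertex set S from V H₁ together with a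
-- duplicate-free list of edges of H inside S, starting from E H₁.  As long
-- as S misses a vertex of H, a path of the connected graph H from a vertex
-- of H₁ to that vertex has an edge leaving S; adding it to the list costs
-- one edge and at most k' new vertices, since it already meets S.

open import Defs
open import Data.Nat using (ℕ)
open import Data.Integer using (ℤ; _≤_)

import Data.Nat as ℕ
open import Data.Nat using (zero; suc; s≤s; s≤s⁻¹; z≤n)
import Data.Nat.Properties as ℕP
import Data.Integer as ℤ
open import Data.Integer using (+_; _⊖_)
import Data.Integer.Properties as ℤP
open import Data.Integer.Tactic.RingSolver using (solve-∀)
import Data.Nat.Tactic.RingSolver as ℕS
open import Data.Product using (_×_; _,_; proj₁; ∃-syntax)
open import Data.Sum using (inj₁; inj₂)
open import Data.Empty using (⊥-elim)
open import Data.List using (List; []; _∷_; length; _++_)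
open import Data.List.Properties using (length-++-sucʳ)
open import Data.List.Relation.Unary.All as All using (All; _∷_)
open import Data.List.Relation.Unary.Any using (here; there)
import Data.List.Relation.Unary.Any.Properties as AnyP
open import Data.List.Relation.Unary.Unique.Propositional using (Unique)
open import Data.List.Relation.Unary.AllPairs using (_∷_)
import Data.List.Membership.Propositional as L
open import Data.List.Membership.Propositional.Properties using (∈-∃++)
open import Data.Fin using (Fin)
open import Data.Fin.Properties using (any?)
open import Data.Vec using ([]; _∷_)
open import Data.Fin.Subset
open import Data.Fin.Subset.Properties
open import Relation.Nullary using (¬_; Dec; yes; no; contradiction)
open import Relation.Nullary.Decidable using (¬?; _×-dec_; decidable-stable)
open import Relation.Binary.PropositionalEquality

inclusion-exclusion : ∀ {n} (p q : Subset n) → ∣ p ∪ q ∣ ℕ.+ ∣ p ∩ q ∣ ≡ ∣ p ∣ ℕ.+ ∣ q ∣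
inclusion-exclusion [] [] = refl
inclusion-exclusion (outside ∷ p) (outside ∷ q) = inclusion-exclusion p q
inclusion-exclusion (outside ∷ p) (inside ∷ q) =
  trans (cong suc (inclusion-exclusion p q)) (sym (ℕP.+-suc ∣ p ∣ ∣ q ∣))
inclusion-exclusion (inside ∷ p) (outside ∷ q) = cong suc (inclusion-exclusion p q)
inclusion-exclusion (inside ∷ p) (inside ∷ q) = cong suc (begin
  ∣ p ∪ q ∣ ℕ.+ suc ∣ p ∩ q ∣  ≡⟨ ℕP.+-suc ∣ p ∪ q ∣ ∣ p ∩ q ∣ ⟩
  suc (∣ p ∪ q ∣ ℕ.+ ∣ p ∩ q ∣) ≡⟨ cong suc (inclusion-exclusion p q) ⟩
  suc (∣ p ∣ ℕ.+ ∣ q ∣)         ≡⟨ ℕP.+-suc ∣ p ∣ ∣ q ∣ ⟨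
  ∣ p ∣ ℕ.+ suc ∣ q ∣           ∎)
  where open ≡-Reasoning

∈⇒∣p∣>0 : ∀ {n} {x : Fin n} {p : Subset n} → x ∈ p → 0 ℕ.< ∣ p ∣
∈⇒∣p∣>0 {x = x} {p} x∈p =
  subst (ℕ._≤ ∣ p ∣) (∣⁅x⁆∣≡1 x)
    (p⊆q⇒∣p∣≤∣q∣ (λ y∈⁅x⁆ → subst (_∈ p) (sym (x∈⁅y⁆⇒x≡y x y∈⁅x⁆)) x∈p))

-- Two overlapping subsets have a union strictly smaller than the sum of
-- their sizes: this is why a new edge meeting S adds at most k - 1 vertices.
overlapping-union : ∀ {n} {x : Fin n} (p q : Subset n) → x ∈ p → x ∈ q →
                    ∣ p ∪ q ∣ ℕ.< ∣ p ∣ ℕ.+ ∣ q ∣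
overlapping-union p q x∈p x∈q = begin-strict
  ∣ p ∪ q ∣                   ≡⟨ ℕP.+-identityʳ _ ⟨
  ∣ p ∪ q ∣ ℕ.+ 0             <⟨ ℕP.+-monoʳ-< ∣ p ∪ q ∣ (∈⇒∣p∣>0 (x∈p∩q⁺ (x∈p , x∈q))) ⟩
  ∣ p ∪ q ∣ ℕ.+ ∣ p ∩ q ∣     ≡⟨ inclusion-exclusion p q ⟩
  ∣ p ∣ ℕ.+ ∣ q ∣             ∎
  where open ℕP.≤-Reasoning

∉⇒∣p∣<n : ∀ {n} {x : Fin n} {p : Subset n} → x ∉ p → ∣ p ∣ ℕ.< n
∉⇒∣p∣<n {n} {x} {p} x∉p =
  subst (∣ p ∣ ℕ.<_) (∣⊤∣≡n n) (p⊂q⇒∣p∣<∣q∣ ((λ _ → ∈⊤) , x , ∈⊤ , x∉p))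

⊈-witness : ∀ {n} {p q : Subset n} → p ⊈ q → ∃[ x ] (x ∈ p × x ∉ q)
⊈-witness {p = p} {q} p⊈q with any? (λ x → (x ∈? p) ×-dec ¬? (x ∈? q))
... | yes witness = witness
... | no none = ⊥-elim (p⊈q p⊆q)
  where
  p⊆q : p ⊆ q
  p⊆q {x} x∈p = decidable-stable (x ∈? q) (λ x∉q → none (x , x∈p , x∉q))

∈⋃⁻ : ∀ {n} (ps : List (Subset n)) {x} → x ∈ ⋃ ps → ∃[ p ] (p L.∈ ps × x ∈ p)
∈⋃⁻ [] x∈ = contradiction x∈ ∉⊥
∈⋃⁻ (p ∷ ps) x∈ with x∈p∪q⁻ p (⋃ ps) x∈
... | inj₁ x∈p = p , here refl , x∈p
... | inj₂ x∈⋃ps with ∈⋃⁻ ps x∈⋃ps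
...   | p' , p'∈ps , x∈p' = p' , there p'∈ps , x∈p'

unique-⊆⇒length-≤ : ∀ {A : Set} (xs ys : List A) → Unique xs →
                    (∀ {x} → x L.∈ xs → x L.∈ ys) → length xs ℕ.≤ length ys
unique-⊆⇒length-≤ [] ys _ _ = z≤n
unique-⊆⇒length-≤ (x ∷ xs) ys (x∉xs ∷ xs-unique) xs⊆ys with ∈-∃++ (xs⊆ys (here refl))
... | us , vs , refl =
  subst (suc (length xs) ℕ.≤_) (sym (length-++-sucʳ us x vs))
    (s≤s (unique-⊆⇒length-≤ xs (us ++ vs) xs-unique xs⊆us++vs))
  where
  -- the elements of xs differ from x, so they survive removing x from ys
  xs⊆us++vs : ∀ {y} → y L.∈ xs → y L.∈ (us ++ vs)
  xs⊆us++vs {y} y∈xs with AnyP.++⁻ us (xs⊆ys (there y∈xs))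
  ... | inj₁ y∈us = AnyP.++⁺ˡ y∈us
  ... | inj₂ (here refl) = contradiction refl (All.lookup x∉xs y∈xs)
  ... | inj₂ (there y∈vs) = AnyP.++⁺ʳ us y∈vs

Leaving : ∀ {N} → List (Subset N) → (Fin N → Set) → Set
Leaving Es Q =
  ∃[ e ] (e L.∈ Es × ∃[ a ] ∃[ b ] (a ∈ e × b ∈ e × Q a × ¬ Q b))

leaving-from-head : ∀ {N} {Es : List (Subset N)} {Q : Fin N → Set} → (∀ x → Dec (Q x)) →
                    ∀ {h vs es} → Chain Es (h ∷ vs) es → Q h →
                    ∀ {y} → y L.∈ (h ∷ vs) → ¬ Q y → Leaving Es Q
leaving-from-head Q? (single h) Qh (here refl) ¬Qy = contradiction Qh ¬Qy
leaving-from-head Q? (step e e∈Es h∈e w∈e chain) Qh (here refl) ¬Qy = contradiction Qh ¬Qy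
leaving-from-head Q? (step {w = w} e e∈Es h∈e w∈e chain) Qh (there y∈) ¬Qy with Q? w
... | yes Qw = leaving-from-head Q? chain Qw y∈ ¬Qy
... | no ¬Qw = e , e∈Es , _ , w , h∈e , w∈e , Qh , ¬Qw

-- A chain visiting both S and its complement has an edge leaving S.  If the
-- chain starts outside S, apply the previous lemma to the complement and
-- swap the two ends of the edge found.
leaving-at-head : ∀ {N} {Es : List (Subset N)} (S : Subset N) → ∀ {h vs es} →
                  Chain Es (h ∷ vs) es → ∀ {x y} → x L.∈ (h ∷ vs) → x ∈ S →
                  y L.∈ (h ∷ vs) → y ∉ S → Leaving Es (_∈ S)
leaving-at-head S {h} chain x∈ x∈S y∈ y∉S with h ∈? S
... | yes h∈S = leaving-from-head (_∈? S) chain h∈S y∈ y∉S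
... | no h∉S with leaving-from-head (λ z → ¬? (z ∈? S)) chain h∉S x∈ (λ x∉S → x∉S x∈S)
...   | e , e∈Es , a , b , a∈e , b∈e , a∉S , ¬b∉S =
        e , e∈Es , b , a , b∈e , a∈e , decidable-stable (b ∈? S) ¬b∉S , a∉S

leaving : ∀ {N} {Es : List (Subset N)} (S : Subset N) → ∀ {vs es} → Chain Es vs es →
          ∀ {x y} → x L.∈ vs → x ∈ S → y L.∈ vs → y ∉ S → Leaving Es (_∈ S)
leaving S chain@(single _) = leaving-at-head S chain
leaving S chain@(step _ _ _ _ _) = leaving-at-head S chain

-- The arithmetic of one growth step: if the invariant holds after adding an
-- edge (one more listed edge, at most k' more vertices), it held before.
step-invariant : ∀ k' v L s s' m → s' ℕ.≤ s ℕ.+ k' →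
                 v ℕ.+ k' ℕ.* suc L ℕ.≤ s' ℕ.+ k' ℕ.* m →
                 v ℕ.+ k' ℕ.* L ℕ.≤ s ℕ.+ k' ℕ.* m
step-invariant k' v L s s' m s'≤s+k' after = ℕP.+-cancelʳ-≤ k' _ _ (begin
  v ℕ.+ k' ℕ.* L ℕ.+ k'    ≡⟨ reorder-before k' v L ⟩
  v ℕ.+ k' ℕ.* suc L       ≤⟨ after ⟩
  s' ℕ.+ k' ℕ.* m          ≤⟨ ℕP.+-monoˡ-≤ (k' ℕ.* m) s'≤s+k' ⟩
  s ℕ.+ k' ℕ.+ k' ℕ.* m    ≡⟨ reorder-after k' s m ⟩
  s ℕ.+ k' ℕ.* m ℕ.+ k'    ∎)
  where
  open ℕP.≤-Reasoning
  reorder-before : ∀ k' v L → v ℕ.+ k' ℕ.* L ℕ.+ k' ≡ v ℕ.+ k' ℕ.* suc L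
  reorder-before = ℕS.solve-∀
  reorder-after : ∀ k' s m → s ℕ.+ k' ℕ.+ k' ℕ.* m ≡ s ℕ.+ k' ℕ.* m ℕ.+ k'
  reorder-after = ℕS.solve-∀

-- Repeatedly adding an edge that leaves S, until S covers
-- V H, shows  n(H) + k'·|Ls| ≤ |S| + k'·m(H).  The fuel bounds the number
-- of additions, as each one enlarges S.
growth-bound : ∀ {N k'} (H : KGraph N (suc k')) → Connected H →
               (fuel : ℕ) (S : Subset N) (Ls : List (Subset N)) {u : Fin N} →
               N ℕ.≤ ∣ S ∣ ℕ.+ fuel → u ∈ S → u ∈ V H →
               Unique Ls → (∀ {e} → e L.∈ Ls → e L.∈ E H) → All (_⊆ S) Ls →
               nV H ℕ.+ k' ℕ.* length Ls ℕ.≤ ∣ S ∣ ℕ.+ k' ℕ.* mE H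
growth-bound {N} {k'} H connected fuel S Ls {u} N≤S+fuel u∈S u∈V Ls-unique Ls⊆E Ls⊆S
  with V H ⊆? S
... | yes V⊆S =
  ℕP.+-mono-≤ (p⊆q⇒∣p∣≤∣q∣ V⊆S) (ℕP.*-monoʳ-≤ k' (unique-⊆⇒length-≤ Ls (E H) Ls-unique Ls⊆E))
... | no V⊈S with ⊈-witness V⊈S
...   | w , w∈V , w∉S with connected u w u∈V w∈V
...     | P , u∈P , w∈P with leaving S (chain P) u∈P u∈S w∈P w∉S
...       | e , e∈E , a , b , a∈e , b∈e , a∈S , b∉S = add-edge fuel N≤S+fuel
  where
  S' : Subset N
  S' = S ∪ e

  -- e meets S in a, so it brings at most k' new vertices
  S'≤S+k' : ∣ S' ∣ ℕ.≤ ∣ S ∣ ℕ.+ k'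
  S'≤S+k' = s≤s⁻¹ (begin-strict
    ∣ S' ∣                  <⟨ overlapping-union S e a∈S a∈e ⟩
    ∣ S ∣ ℕ.+ ∣ e ∣         ≡⟨ cong (∣ S ∣ ℕ.+_) (All.lookup (E-card H) e∈E) ⟩
    ∣ S ∣ ℕ.+ suc k'        ≡⟨ ℕP.+-suc ∣ S ∣ k' ⟩
    suc (∣ S ∣ ℕ.+ k')      ∎)
    where open ℕP.≤-Reasoning

  -- e contains b ∉ S, so it is new and S strictly grows
  S<S' : ∣ S ∣ ℕ.< ∣ S' ∣
  S<S' = p⊂q⇒∣p∣<∣q∣ (p⊆p∪q e , b , x∈p∪q⁺ (inj₂ b∈e) , b∉S)

  e∉Ls : All (e ≢_) Ls
  e∉Ls = All.map (λ e'⊆S e≡e' → b∉S (e'⊆S (subst (b ∈_) e≡e' b∈e))) Ls⊆S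

  e∷Ls⊆E : ∀ {e'} → e' L.∈ (e ∷ Ls) → e' L.∈ E H
  e∷Ls⊆E (here refl) = e∈E
  e∷Ls⊆E (there e'∈Ls) = Ls⊆E e'∈Ls

  e∷Ls⊆S' : All (_⊆ S') (e ∷ Ls)
  e∷Ls⊆S' = q⊆p∪q S e ∷ All.map (λ e'⊆S {_} x∈e' → p⊆p∪q e (e'⊆S x∈e')) Ls⊆S

  add-edge : (fuel : ℕ) → N ℕ.≤ ∣ S ∣ ℕ.+ fuel →
             nV H ℕ.+ k' ℕ.* length Ls ℕ.≤ ∣ S ∣ ℕ.+ k' ℕ.* mE H
  add-edge zero N≤S = contradiction (subst (N ℕ.≤_) (ℕP.+-identityʳ _) N≤S)
                                    (ℕP.<⇒≱ (∉⇒∣p∣<n b∉S))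
  add-edge (suc fuel) N≤S+fuel =
    step-invariant k' (nV H) (length Ls) ∣ S ∣ ∣ S' ∣ (mE H) S'≤S+k'
      (growth-bound H connected fuel S' (e ∷ Ls) N≤S'+fuel (p⊆p∪q e u∈S) u∈V
        (e∉Ls ∷ Ls-unique) e∷Ls⊆E e∷Ls⊆S')
    where
    N≤S'+fuel : N ℕ.≤ ∣ S' ∣ ℕ.+ fuel
    N≤S'+fuel = ℕP.≤-trans N≤S+fuel
      (ℕP.≤-trans (ℕP.≤-reflexive (ℕP.+-suc ∣ S ∣ fuel)) (ℕP.+-monoˡ-≤ fuel S<S'))

subgraph-vertex-in-edge : ∀ {N k} (H₁ H : KGraph N k) → Subgraph H₁ H →
                          ∀ {x} → x ∈ V H₁ → ∃[ e ] (e L.∈ E H₁ × x ∈ e)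
subgraph-vertex-in-edge H₁ H (_ , V₁≡⋃E₁) {x} x∈V₁ = ∈⋃⁻ _ (subst (x ∈_) V₁≡⋃E₁ x∈V₁)

subgraph-vertices : ∀ {N k} (H₁ H : KGraph N k) → Subgraph H₁ H → V H₁ ⊆ V H
subgraph-vertices H₁ H sub x∈V₁ with subgraph-vertex-in-edge H₁ H sub x∈V₁
... | e , e∈E₁ , x∈e = All.lookup (E-sub H) (proj₁ sub e e∈E₁) x∈e

cyclic-rank : ∀ {N k'} {r : ℤ} (H : KGraph N (suc k')) → Cyclic r H →
              r ≡ (k' ℕ.* mE H ℕ.+ 1) ⊖ nV H
cyclic-rank {k' = k'} {r} H (_ , n≡) = begin
  r                                  ≡⟨ solve-for-r r (+ mE H ℤ.* + k') ⟩
  + mE H ℤ.* + k' ℤ.+ + 1 ℤ.- (+ mE H ℤ.* + k' ℤ.- r ℤ.+ + 1)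
                                     ≡⟨ cong (λ z → + mE H ℤ.* + k' ℤ.+ + 1 ℤ.- z) n≡ ⟨
  + mE H ℤ.* + k' ℤ.+ + 1 ℤ.- + nV H ≡⟨ cong (λ z → z ℤ.+ + 1 ℤ.- + nV H) mk'≡k'm ⟩
  + (k' ℕ.* mE H ℕ.+ 1) ℤ.- + nV H  ≡⟨ ℤP.m-n≡m⊖n (k' ℕ.* mE H ℕ.+ 1) (nV H) ⟩
  (k' ℕ.* mE H ℕ.+ 1) ⊖ nV H         ∎
  where
  open ≡-Reasoning
  solve-for-r : ∀ r x → r ≡ x ℤ.+ + 1 ℤ.- (x ℤ.- r ℤ.+ + 1)
  solve-for-r = solve-∀
  mk'≡k'm : + mE H ℤ.* + k' ≡ + (k' ℕ.* mE H)
  mk'≡k'm = trans (ℤP.*-comm (+ mE H) (+ k')) (sym (ℤP.pos-* k' (mE H)))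

⊖-mono-≤ : ∀ a n a₁ n₁ → n ℕ.+ a₁ ℕ.≤ n₁ ℕ.+ a → a₁ ⊖ n₁ ≤ a ⊖ n
⊖-mono-≤ a n a₁ n₁ cross = begin
  a₁ ⊖ n₁                    ≡⟨ ℤP.+-cancelˡ-⊖ n a₁ n₁ ⟨
  (n ℕ.+ a₁) ⊖ (n ℕ.+ n₁)    ≤⟨ ℤP.⊖-monoˡ-≤ (n ℕ.+ n₁) cross ⟩
  (n₁ ℕ.+ a) ⊖ (n ℕ.+ n₁)    ≡⟨ cong ((n₁ ℕ.+ a) ⊖_) (ℕP.+-comm n n₁) ⟩
  (n₁ ℕ.+ a) ⊖ (n₁ ℕ.+ n)    ≡⟨ ℤP.+-cancelˡ-⊖ n₁ a n ⟩
  a ⊖ n                      ∎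
  where open ℤP.≤-Reasoning

lemma2p1 : ∀ {N k : ℕ} (H H₁ : KGraph N k) (r r₁ : ℤ) →
    Cyclic r H → Subgraph H₁ H → Connected H₁ → Cyclic r₁ H₁ → r₁ ≤ r
lemma2p1 {k = zero} H H₁ r r₁ _ sub _ _ with V-ne H₁
... | u , u∈V₁ with subgraph-vertex-in-edge H₁ H sub u∈V₁
...   | e , e∈E₁ , u∈e =
        contradiction (subst (0 ℕ.<_) (All.lookup (E-card H₁) e∈E₁) (∈⇒∣p∣>0 u∈e)) (λ ())
lemma2p1 {N} {suc k'} H H₁ r r₁ cyclic@(connected , _) sub _ cyclic₁ =
  subst₂ _≤_ (sym (cyclic-rank H₁ cyclic₁)) (sym (cyclic-rank H cyclic))
    (⊖-mono-≤ (k' ℕ.* mE H ℕ.+ 1) (nV H) (k' ℕ.* mE H₁ ℕ.+ 1) (nV H₁) counting)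
  where
  edge-count : nV H ℕ.+ k' ℕ.* mE H₁ ℕ.≤ nV H₁ ℕ.+ k' ℕ.* mE H
  edge-count with V-ne H₁
  ... | u , u∈V₁ =
    growth-bound H connected N (V H₁) (E H₁) (ℕP.m≤n+m N (nV H₁)) u∈V₁
      (subgraph-vertices H₁ H sub u∈V₁) (E-uniq H₁) (proj₁ sub _) (E-sub H₁)
  counting : nV H ℕ.+ (k' ℕ.* mE H₁ ℕ.+ 1) ℕ.≤ nV H₁ ℕ.+ (k' ℕ.* mE H ℕ.+ 1)
  counting = subst₂ ℕ._≤_ (ℕP.+-assoc (nV H) _ 1) (ℕP.+-assoc (nV H₁) _ 1)
               (ℕP.+-monoˡ-≤ 1 edge-count)
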